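{- Let $n$ be a non-negative integer. If $\{(s_k),(\sigma_k)\}$ and $\{(t_k),(\tau_k)\}$, $k=0,1,2,\ldots$, are binomial-transform pairs of the first kind, then \[ \sum_{k=0}^n (-1)^{n-k}\binom{n}{k} s_k\, t_{n-k} = \sum_{k=0}^n (-1)^k \binom{n}{k}\sigma_k\, \tau_{n-k}. \]
   Context: Two sequences $(s_k)_{k\ge0}$ and $(\sigma_k)_{k\ge0}$ of complex numbers form a binomial-transform pair of the first kind if $\sigma_n=\sum_{k=0}^n(-1)^k\binom nk s_k$ for every non-negative integer $n$ (equivalently, $s_n=\sum_{k=0}^n(-1)^k\binom nk\sigma_k$ for every $n\ge 0$). -}

module Defs where

open import Level using (Level)
open import Algebra.Bundles using (CommutativeRing)
open import Data.Nat using (ℕ; zero; suc; _∸_)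
open import Data.Nat.Combinatorics using (_C_)

-- Definitions relative to an arbitrary commutative ring R
-- (the paper works with complex numbers).
module _ {c ℓ : Level} (R : CommutativeRing c ℓ) where
  open CommutativeRing R

  natR : ℕ → Carrier
  natR zero    = 0#
  natR (suc n) = 1# + natR n

  sgn : ℕ → Carrier
  sgn zero    = 1#
  sgn (suc k) = - 1# * sgn k

  sumTo : ℕ → (ℕ → Carrier) → Carrier
  sumTo zero    f = f 0
  sumTo (suc n) f = sumTo n f + f (suc n)

  BinomialPair : (ℕ → Carrier) → (ℕ → Carrier) → Set ℓ
  BinomialPair s σ =
    ∀ n → σ n ≈ sumTo n (λ k → sgn k * natR (n C k) * s k)

-- Write ∇f k = f k − f (k + 1).  Shifting s to k ↦ s (k + 1) turns its transform σ into ∇σ,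
-- and Pascal's rule shows that both sides of the identity obey the same recursion in n:
-- the left side at n + 1 is the left side at n for (s ∘ suc, t) minus that for (s, t ∘ suc),
-- the right side at n + 1 is the right side at n for (∇σ, τ) minus that for (σ, ∇τ).
-- Induction on n, over all pairs at once, then reduces the identity to n = 0, where it reads
-- s₀ t₀ = σ₀ τ₀.
module Submission where

open import Defs
open import Level using (Level)
open import Algebra.Bundles using (CommutativeRing)
open import Data.Nat as ℕ using (ℕ; _∸_; zero; suc; _≤_; z≤n)
open import Data.Nat.Combinatorics using (_C_; nCk+nC[k+1]≡[n+1]C[k+1])
open import Data.Nat.Properties using (m≤n⇒m≤1+n; ≤-refl; n<1+n; +-∸-assoc)
open import Data.Nat.Combinatorics.Specification using (k>n⇒nCk≡0)
open import Function.Base using (_∘_)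
open import Relation.Binary.PropositionalEquality.Core using (cong)
import Algebra.Properties.Ring as RingProperties
import Algebra.Properties.CommutativeSemigroup as CommutativeSemigroupProperties
import Relation.Binary.Reasoning.Setoid as SetoidReasoning

module _ {c ℓ : Level} (R : CommutativeRing c ℓ) where
  open CommutativeRing R
  open RingProperties ring
  open CommutativeSemigroupProperties +-commutativeSemigroup using (interchange; x∙yz≈y∙xz)
  open CommutativeSemigroupProperties *-commutativeSemigroup using (xy∙z≈y∙xz)
  open SetoidReasoning setoid

  private
    [x-y]-[x-z]≈-y+z : ∀ x y z → (x - y) - (x - z) ≈ - y + z
    [x-y]-[x-z]≈-y+z x y z = begin
      (x - y) - (x - z)     ≈⟨ +-cong (+-comm x (- y)) (⁻¹-anti-homo‿- x z) ⟩
      (- y + x) + (z - x)   ≈⟨ +-assoc (- y) x (z - x) ⟩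
      - y + (x + (z - x))   ≈⟨ +-congˡ (+-assoc x z (- x)) ⟨
      - y + (x + z - x)     ≈⟨ +-congˡ (xyx⁻¹≈y x z) ⟩
      - y + z               ∎

    a*b*x*y≈b*[a*x*y] : ∀ a b x y → a * b * x * y ≈ b * (a * x * y)
    a*b*x*y≈b*[a*x*y] a b x y = trans (*-congʳ (xy∙z≈y∙xz a b x)) (*-assoc b (a * x) y)

    x-[-y+x]≈y : ∀ x y → x - (- y + x) ≈ y
    x-[-y+x]≈y x y = begin
      x - (- y + x)     ≈⟨ +-congˡ (-‿+-comm (- y) x) ⟨
      x + (- - y + - x) ≈⟨ +-congˡ (+-congʳ (-‿involutive y)) ⟩
      x + (y - x)       ≈⟨ +-assoc x y (- x) ⟨
      x + y - x         ≈⟨ xyx⁻¹≈y x y ⟩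
      y                 ∎

  sumTo-cong : ∀ n {f g : ℕ → Carrier} → (∀ k → k ≤ n → f k ≈ g k) → sumTo R n f ≈ sumTo R n g
  sumTo-cong zero    f≈g = f≈g 0 z≤n
  sumTo-cong (suc n) f≈g = +-cong (sumTo-cong n (λ k k≤n → f≈g k (m≤n⇒m≤1+n k≤n))) (f≈g (suc n) ≤-refl)

  sumTo-distrib-+ : ∀ n (f g : ℕ → Carrier) → sumTo R n (λ k → f k + g k) ≈ sumTo R n f + sumTo R n g
  sumTo-distrib-+ zero    f g = refl
  sumTo-distrib-+ (suc n) f g = trans (+-congʳ (sumTo-distrib-+ n f g)) (interchange _ _ _ _)

  sumTo-neg : ∀ n (f : ℕ → Carrier) → sumTo R n (λ k → - f k) ≈ - sumTo R n f
  sumTo-neg zero    f = refl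
  sumTo-neg (suc n) f = trans (+-congʳ (sumTo-neg n f)) (-‿+-comm _ _)

  sumTo-head : ∀ n (f : ℕ → Carrier) → sumTo R (suc n) f ≈ f 0 + sumTo R n (f ∘ suc)
  sumTo-head zero    f = refl
  sumTo-head (suc n) f = trans (+-congʳ (sumTo-head n f)) (+-assoc _ _ _)

  natR-+ : ∀ m n → natR R (m ℕ.+ n) ≈ natR R m + natR R n
  natR-+ zero    n = sym (+-identityˡ _)
  natR-+ (suc m) n = trans (+-congˡ (natR-+ m n)) (sym (+-assoc _ _ _))

  binomialSum : ℕ → (ℕ → ℕ → Carrier) → Carrier
  binomialSum n g = sumTo R n (λ k → natR R (n C k) * g k (n ∸ k))

  binomialSum-cong : ∀ n {g h : ℕ → ℕ → Carrier} → (∀ i j → g i j ≈ h i j) →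
                     binomialSum n g ≈ binomialSum n h
  binomialSum-cong n g≈h = sumTo-cong n (λ k _ → *-congˡ (g≈h k (n ∸ k)))

  binomialSum-distrib-+ : ∀ n (g h : ℕ → ℕ → Carrier) →
                          binomialSum n (λ i j → g i j + h i j) ≈ binomialSum n g + binomialSum n h
  binomialSum-distrib-+ n g h = trans (sumTo-cong n (λ k _ → distribˡ _ _ _)) (sumTo-distrib-+ n _ _)

  binomialSum-neg : ∀ n (g : ℕ → ℕ → Carrier) → binomialSum n (λ i j → - g i j) ≈ - binomialSum n g
  binomialSum-neg n g = trans (sumTo-cong n (λ k _ → sym (-‿distribʳ-* _ _))) (sumTo-neg n _)

  binomialSum-distrib-- : ∀ n (g h : ℕ → ℕ → Carrier) →
                          binomialSum n (λ i j → g i j - h i j) ≈ binomialSum n g - binomialSum n h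
  binomialSum-distrib-- n g h =
    trans (binomialSum-distrib-+ n g (λ i j → - h i j)) (+-congˡ (binomialSum-neg n h))

  binomialSum-suc : ∀ n (g : ℕ → ℕ → Carrier) →
                    binomialSum (suc n) g
                    ≈ binomialSum n (λ i j → g (suc i) j) + binomialSum n (λ i j → g i (suc j))
  binomialSum-suc n g = begin
    binomialSum (suc n) g
      ≈⟨ sumTo-head n _ ⟩
    head + sumTo R n (λ k → natR R (suc n C suc k) * g (suc k) (n ∸ k))
      ≈⟨ +-congˡ (trans (sumTo-cong n (λ k _ → pascal k)) (sumTo-distrib-+ n _ _)) ⟩
    head + (binomialSum n (λ i j → g (suc i) j) + rest)
      ≈⟨ x∙yz≈y∙xz head _ rest ⟩
    binomialSum n (λ i j → g (suc i) j) + (head + rest)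
      ≈⟨ +-congˡ shiftedʳ ⟨
    binomialSum n (λ i j → g (suc i) j) + binomialSum n (λ i j → g i (suc j)) ∎
    where
    head : Carrier
    head = natR R 1 * g 0 (suc n)
    rest : Carrier
    rest = sumTo R n (λ k → natR R (n C suc k) * g (suc k) (n ∸ k))

    pascal : ∀ k → natR R (suc n C suc k) * g (suc k) (n ∸ k)
                   ≈ natR R (n C k) * g (suc k) (n ∸ k) + natR R (n C suc k) * g (suc k) (n ∸ k)
    pascal k = begin
      natR R (suc n C suc k) * g (suc k) (n ∸ k)
        ≈⟨ *-congʳ (reflexive (cong (natR R) (nCk+nC[k+1]≡[n+1]C[k+1] n k))) ⟨
      natR R (n C k ℕ.+ n C suc k) * g (suc k) (n ∸ k)
        ≈⟨ *-congʳ (natR-+ (n C k) (n C suc k)) ⟩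
      (natR R (n C k) + natR R (n C suc k)) * g (suc k) (n ∸ k)
        ≈⟨ distribʳ _ _ _ ⟩
      natR R (n C k) * g (suc k) (n ∸ k) + natR R (n C suc k) * g (suc k) (n ∸ k) ∎

    -- shifting j ↦ j + 1 adds the term k = n + 1, which vanishes as n C (n + 1) = 0
    shiftedʳ : binomialSum n (λ i j → g i (suc j)) ≈ head + rest
    shiftedʳ = begin
      binomialSum n (λ i j → g i (suc j))
        ≈⟨ sumTo-cong n (λ k k≤n → *-congˡ (reflexive (cong (g k) (+-∸-assoc 1 k≤n)))) ⟨
      sumTo R n h
        ≈⟨ +-identityʳ _ ⟨
      sumTo R n h + 0#
        ≈⟨ +-congˡ (trans (*-congʳ (reflexive (cong (natR R) (k>n⇒nCk≡0 (n<1+n n))))) (zeroˡ _)) ⟨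
      sumTo R (suc n) h
        ≈⟨ sumTo-head n h ⟩
      head + rest ∎
      where
      h : ℕ → Carrier
      h k = natR R (n C k) * g k (suc n ∸ k)

  BinomialPair⇒binomialSum : ∀ {s σ} → BinomialPair R s σ →
                             ∀ n → σ n ≈ binomialSum n (λ i _ → sgn R i * s i)
  BinomialPair⇒binomialSum p n = trans (p n) (sumTo-cong n (λ k _ → xy∙z≈y∙xz _ _ _))

  binomialSum⇒BinomialPair : ∀ {s σ} → (∀ n → σ n ≈ binomialSum n (λ i _ → sgn R i * s i)) →
                             BinomialPair R s σ
  binomialSum⇒BinomialPair e n = trans (e n) (sumTo-cong n (λ k _ → sym (xy∙z≈y∙xz _ _ _)))

  BinomialPair-zero : ∀ {s σ} → BinomialPair R s σ → s 0 ≈ σ 0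
  BinomialPair-zero {s} {σ} p = sym (begin
    σ 0                  ≈⟨ p 0 ⟩
    1# * (1# + 0#) * s 0 ≈⟨ *-congʳ (trans (*-identityˡ _) (+-identityʳ _)) ⟩
    1# * s 0             ≈⟨ *-identityˡ _ ⟩
    s 0                  ∎)

  sgn-suc : ∀ k x → sgn R (suc k) * x ≈ - (sgn R k * x)
  sgn-suc k x = trans (*-congʳ (-1*x≈-x (sgn R k))) (sym (-‿distribˡ-* (sgn R k) x))

  sgn-suc-* : ∀ k x y → sgn R (suc k) * x * y ≈ - (sgn R k * x * y)
  sgn-suc-* k x y = trans (*-congʳ (sgn-suc k x)) (sym (-‿distribˡ-* (sgn R k * x) y))

  ∇ : (ℕ → Carrier) → ℕ → Carrier
  ∇ f k = f k - f (suc k)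

  BinomialPair-shift : ∀ {s σ} → BinomialPair R s σ → BinomialPair R (s ∘ suc) (∇ σ)
  BinomialPair-shift {s} {σ} p = binomialSum⇒BinomialPair ∇σ-as-binomialSum
    where
    ∇σ-as-binomialSum : ∀ n → ∇ σ n ≈ binomialSum n (λ i _ → sgn R i * s (suc i))
    ∇σ-as-binomialSum n = begin
      σ n - σ (suc n)
        ≈⟨ +-congˡ (-‿cong (trans (BinomialPair⇒binomialSum p (suc n))
                                  (binomialSum-suc n (λ i _ → sgn R i * s i)))) ⟩
      σ n - (binomialSum n (λ i _ → sgn R (suc i) * s (suc i)) + binomialSum n (λ i _ → sgn R i * s i))
        ≈⟨ +-congˡ (-‿cong (+-cong shifted (sym (BinomialPair⇒binomialSum p n)))) ⟩
      σ n - (- binomialSum n (λ i _ → sgn R i * s (suc i)) + σ n)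
        ≈⟨ x-[-y+x]≈y (σ n) _ ⟩
      binomialSum n (λ i _ → sgn R i * s (suc i)) ∎
      where
      shifted : binomialSum n (λ i _ → sgn R (suc i) * s (suc i))
                ≈ - binomialSum n (λ i _ → sgn R i * s (suc i))
      shifted = trans (binomialSum-cong n (λ i _ → sgn-suc i (s (suc i))))
                      (binomialSum-neg n (λ i _ → sgn R i * s (suc i)))

  altConvʳ : ℕ → (ℕ → Carrier) → (ℕ → Carrier) → Carrier
  altConvʳ n s t = binomialSum n (λ i j → sgn R j * s i * t j)

  altConvˡ : ℕ → (ℕ → Carrier) → (ℕ → Carrier) → Carrier
  altConvˡ n σ τ = binomialSum n (λ i j → sgn R i * σ i * τ j)

  altConvʳ-suc : ∀ n s t → altConvʳ (suc n) s t ≈ altConvʳ n (s ∘ suc) t - altConvʳ n s (t ∘ suc)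
  altConvʳ-suc n s t = begin
    altConvʳ (suc n) s t
      ≈⟨ binomialSum-suc n (λ i j → sgn R j * s i * t j) ⟩
    altConvʳ n (s ∘ suc) t + binomialSum n (λ i j → sgn R (suc j) * s i * t (suc j))
      ≈⟨ +-congˡ (binomialSum-cong n (λ i j → sgn-suc-* j (s i) (t (suc j)))) ⟩
    altConvʳ n (s ∘ suc) t + binomialSum n (λ i j → - (sgn R j * s i * t (suc j)))
      ≈⟨ +-congˡ (binomialSum-neg n (λ i j → sgn R j * s i * t (suc j))) ⟩
    altConvʳ n (s ∘ suc) t - altConvʳ n s (t ∘ suc) ∎

  altConvˡ-suc : ∀ n σ τ → altConvˡ (suc n) σ τ ≈ altConvˡ n (∇ σ) τ - altConvˡ n σ (∇ τ)
  altConvˡ-suc n σ τ = begin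
    altConvˡ (suc n) σ τ
      ≈⟨ binomialSum-suc n (λ i j → sgn R i * σ i * τ j) ⟩
    binomialSum n (λ i j → sgn R (suc i) * σ (suc i) * τ j)
      + binomialSum n (λ i j → sgn R i * σ i * τ (suc j))
      ≈⟨ binomialSum-distrib-+ n (λ i j → sgn R (suc i) * σ (suc i) * τ j)
                                 (λ i j → sgn R i * σ i * τ (suc j)) ⟨
    binomialSum n (λ i j → sgn R (suc i) * σ (suc i) * τ j + sgn R i * σ i * τ (suc j))
      ≈⟨ binomialSum-cong n product-rule ⟨
    binomialSum n (λ i j → sgn R i * ∇ σ i * τ j - sgn R i * σ i * ∇ τ j)
      ≈⟨ binomialSum-distrib-- n (λ i j → sgn R i * ∇ σ i * τ j) (λ i j → sgn R i * σ i * ∇ τ j) ⟩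
    altConvˡ n (∇ σ) τ - altConvˡ n σ (∇ τ) ∎
    where
    product-rule : ∀ i j → sgn R i * ∇ σ i * τ j - sgn R i * σ i * ∇ τ j
                           ≈ sgn R (suc i) * σ (suc i) * τ j + sgn R i * σ i * τ (suc j)
    product-rule i j = begin
      sgn R i * ∇ σ i * τ j - sgn R i * σ i * ∇ τ j
        ≈⟨ +-cong (trans (*-congʳ (x[y-z]≈xy-xz _ _ _)) ([y-z]x≈yx-zx _ _ _))
                  (-‿cong (x[y-z]≈xy-xz _ _ _)) ⟩
      (a * σ i * τ j - a * σ (suc i) * τ j) - (a * σ i * τ j - a * σ i * τ (suc j))
        ≈⟨ [x-y]-[x-z]≈-y+z _ _ _ ⟩
      - (a * σ (suc i) * τ j) + a * σ i * τ (suc j)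
        ≈⟨ +-congʳ (sgn-suc-* i (σ (suc i)) (τ j)) ⟨
      sgn R (suc i) * σ (suc i) * τ j + sgn R i * σ i * τ (suc j) ∎
      where
      a : Carrier
      a = sgn R i

  altConvʳ≈altConvˡ : ∀ n {s σ t τ} → BinomialPair R s σ → BinomialPair R t τ →
                      altConvʳ n s t ≈ altConvˡ n σ τ
  altConvʳ≈altConvˡ zero    p q = *-congˡ (*-cong (*-congˡ (BinomialPair-zero p)) (BinomialPair-zero q))
  altConvʳ≈altConvˡ (suc n) {s} {σ} {t} {τ} p q = begin
    altConvʳ (suc n) s t
      ≈⟨ altConvʳ-suc n s t ⟩
    altConvʳ n (s ∘ suc) t - altConvʳ n s (t ∘ suc)
      ≈⟨ +-cong (altConvʳ≈altConvˡ n (BinomialPair-shift p) q)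
                (-‿cong (altConvʳ≈altConvˡ n p (BinomialPair-shift q))) ⟩
    altConvˡ n (∇ σ) τ - altConvˡ n σ (∇ τ)
      ≈⟨ altConvˡ-suc n σ τ ⟨
    altConvˡ (suc n) σ τ ∎

  altConvʳ-as-sumTo : ∀ n s t →
    altConvʳ n s t ≈ sumTo R n (λ k → sgn R (n ∸ k) * natR R (n C k) * s k * t (n ∸ k))
  altConvʳ-as-sumTo n s t = sumTo-cong n (λ k _ → sym (a*b*x*y≈b*[a*x*y] _ _ _ _))

  altConvˡ-as-sumTo : ∀ n σ τ →
    altConvˡ n σ τ ≈ sumTo R n (λ k → sgn R k * natR R (n C k) * σ k * τ (n ∸ k))
  altConvˡ-as-sumTo n σ τ = sumTo-cong n (λ k _ → sym (a*b*x*y≈b*[a*x*y] _ _ _ _))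

theorem1 : {c ℓ : Level} (R : CommutativeRing c ℓ) →
    let open CommutativeRing R in
    (s σ t τ : ℕ → Carrier) →
    BinomialPair R s σ → BinomialPair R t τ →
    (n : ℕ) →
    sumTo R n (λ k → sgn R (n ∸ k) * natR R (n C k) * s k * t (n ∸ k))
      ≈ sumTo R n (λ k → sgn R k * natR R (n C k) * σ k * τ (n ∸ k))
theorem1 R s σ t τ p q n = begin
  sumTo R n (λ k → sgn R (n ∸ k) * natR R (n C k) * s k * t (n ∸ k)) ≈⟨ altConvʳ-as-sumTo R n s t ⟨
  altConvʳ R n s t                                                   ≈⟨ altConvʳ≈altConvˡ R n p q ⟩
  altConvˡ R n σ τ                                                   ≈⟨ altConvˡ-as-sumTo R n σ τ ⟩
  sumTo R n (λ k → sgn R k * natR R (n C k) * σ k * τ (n ∸ k))       ∎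
  where
  open CommutativeRing R
  open SetoidReasoning setoid
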